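{- Let $M$ be a multigraph (without loops) with $n$ vertices. Then $M$ is the double competition multigraph of an acyclic digraph if and only if there exist an ordering $(v_1,\ldots,v_n)$ of the vertices of $M$ and a double indexed edge clique partition $\{S_{ij}\mid i,j\in[n]\}$ of $M$ such that the following conditions hold: (I) for any $i,j\in[n]$, if $|A_i\cap B_j|\ge 2$, then $A_i\cap B_j=S_{ij}$; (IV) for any $i,j,k\in[n]$, $v_k\in S_{ij}$ implies $i<k<j$, where for $i,j\in[n]$, $A_i=S_{i*}\cup T^+_i$ with $S_{i*}:=\bigcup_{p\in[n]}S_{ip}$ and $T^+_i:=\{v_b\mid a,b\in[n],\ v_i\in S_{ab}\}$, and $B_j=S_{*j}\cup T^-_j$ with $S_{*j}:=\bigcup_{q\in[n]}S_{qj}$ and $T^-_j:=\{v_a\mid a,b\in[n],\ v_j\in S_{ab}\}$.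
   Context: A digraph $D$ consists of a vertex set $V(D)$ and a set $A(D)$ of ordered pairs of vertices (arcs); $D$ is acyclic if it has no directed cycles (in particular no loops). $N^+_D(x)=\{v\mid (x,v)\in A(D)\}$ and $N^-_D(x)=\{v\mid (v,x)\in A(D)\}$. A multigraph $M$ is a vertex set $V(M)$ together with a function $m_M$ assigning to each unordered pair $\{x,y\}$ of distinct vertices a nonnegative integer (the number of edges between $x$ and $y$); multigraphs have no loops. The double competition multigraph of a digraph $D$ is the multigraph $M$ with $V(M)=V(D)$ and $m_M(\{x,y\})=|N^+_D(x)\cap N^+_D(y)|\cdot|N^-_D(x)\cap N^-_D(y)|$ for distinct $x,y$. A clique of $M$ is a set of vertices that are pairwise adjacent (i.e. $m_M\ge 1$ for each pair of distinct members); the empty set (and any single vertex) counts as a clique. An edge clique partition of $M$ is a family (multiset) $\mathcal F$ of cliques of $M$ such that any two distinct vertices $x,y$ are contained together in exactly $m_M(\{x,y\})$ members of $\mathcal F$. A double indexed edge clique partition $\{S_{ij}\mid i,j\in[n]\}$ is such a family indexed by pairs in $[n]\times[n]$, where $[n]=\{1,\ldots,n\}$. -}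

module Defs where

open import Data.Nat using (ℕ; _≥_; _+_)
open import Data.Bool using (Bool; true; false; _∧_; if_then_else_)
open import Data.Fin using (Fin; _<_)
open import Data.Fin.Subset using (Subset; _∈_)
open import Data.List using (List; length; filter; allFin; concatMap; map)
open import Data.List.Base using (cartesianProduct)
open import Data.Vec using (lookup)
open import Data.Product using (_×_; _,_; ∃; ∃-syntax; proj₁; proj₂)
open import Data.Sum using (_⊎_)
open import Data.Empty using (⊥)
open import Relation.Nullary using (¬_)
open import Relation.Binary.PropositionalEquality using (_≡_; _≢_)
open import Data.Fin.Permutation using (Permutation′; _⟨$⟩ʳ_)
open import Function.Bundles using (_⇔_)

-- Multigraphs on vertex set Fin n (no loops).
-- mult x y = number of edges between x and y; symmetric.
-- Diagonal values mult x x are never used (no loops).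
record Multigraph (n : ℕ) : Set where
  field
    mult : Fin n → Fin n → ℕ
    sym  : ∀ x y → mult x y ≡ mult y x
open Multigraph public

Digraph : ℕ → Set
Digraph n = Fin n → Fin n → Bool

data Walk {n : ℕ} (D : Digraph n) : Fin n → Fin n → Set where
  arc  : ∀ {x y} → D x y ≡ true → Walk D x y
  _▸_  : ∀ {x y z} → D x y ≡ true → Walk D y z → Walk D x z

Acyclic : ∀ {n} → Digraph n → Set
Acyclic D = ∀ x → ¬ Walk D x x

count : ∀ {n} → (Fin n → Bool) → ℕ
count {n} p = length (filter (λ v → p v Data.Bool.≟ true) (allFin n))

commonOut : ∀ {n} → Digraph n → Fin n → Fin n → ℕ
commonOut D x y = count (λ v → D x v ∧ D y v)

commonIn : ∀ {n} → Digraph n → Fin n → Fin n → ℕ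
commonIn D x y = count (λ v → D v x ∧ D v y)

IsDCM : ∀ {n} → Multigraph n → Digraph n → Set
IsDCM {n} M D = ∀ (x y : Fin n) → x ≢ y →
  mult M x y ≡ commonOut D x y Data.Nat.* commonIn D x y

IsClique : ∀ {n} → Multigraph n → Subset n → Set
IsClique M S = ∀ x y → x ∈ S → y ∈ S → x ≢ y → mult M x y ≥ 1

pairCount : ∀ {n} → (Fin n → Fin n → Subset n) → Fin n → Fin n → ℕ
pairCount {n} S x y =
  length (filter (λ ij → (lookup (S (proj₁ ij) (proj₂ ij)) x ∧ lookup (S (proj₁ ij) (proj₂ ij)) y) Data.Bool.≟ true)
                 (cartesianProduct (allFin n) (allFin n)))

IsDoubleIndexedECP : ∀ {n} → Multigraph n → (Fin n → Fin n → Subset n) → Set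
IsDoubleIndexedECP {n} M S =
  (∀ i j → IsClique M (S i j)) ×
  (∀ (x y : Fin n) → x ≢ y → pairCount S x y ≡ mult M x y)

module _ {n : ℕ} (v : Permutation′ n) (S : Fin n → Fin n → Subset n) where

  vtx : Fin n → Fin n
  vtx k = v ⟨$⟩ʳ k

  InSrow : Fin n → Fin n → Set
  InSrow i x = ∃[ p ] x ∈ S i p

  InTplus : Fin n → Fin n → Set
  InTplus i x = ∃[ a ] ∃[ b ] (vtx i ∈ S a b × x ≡ vtx b)

  InA : Fin n → Fin n → Set
  InA i x = InSrow i x ⊎ InTplus i x

  InScol : Fin n → Fin n → Set
  InScol j x = ∃[ q ] x ∈ S q j

  InTminus : Fin n → Fin n → Set
  InTminus j x = ∃[ a ] ∃[ b ] (vtx j ∈ S a b × x ≡ vtx a)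

  InB : Fin n → Fin n → Set
  InB j x = InScol j x ⊎ InTminus j x

  AtLeastTwo : Fin n → Fin n → Set
  AtLeastTwo i j = ∃[ x ] ∃[ y ] (x ≢ y × (InA i x × InB j x) × (InA i y × InB j y))

  CondI : Set
  CondI = ∀ i j → AtLeastTwo i j → ∀ x → ((InA i x × InB j x) ⇔ (x ∈ S i j))

  CondIV : Set
  CondIV = ∀ i j k → vtx k ∈ S i j → (i < k × k < j)

-- Given an acyclic D, list its vertices in a topological order v and let S_ij = N⁺(v_i) ∩ N⁻(v_j).
-- Then x and y lie together in S_ij exactly when v_i is a common in-neighbour and v_j a common
-- out-neighbour of x and y, so the number of such (i , j) is the multiplicity in the double
-- competition multigraph; every member of S_ij lies between v_i and v_j in the order.
-- Conversely, put an arc v_i → w whenever w ∈ A_i. Condition (IV) makes every arc increase the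
-- index, so the digraph is acyclic, and by the symmetry v_k ∈ A_i ⇔ v_i ∈ B_k its arcs into v_j
-- come exactly from B_j. Condition (I) shows that distinct x, y lie together in S_ij iff both lie
-- in A_i and in B_j, so the pair count factorises into |N⁻(x) ∩ N⁻(y)| · |N⁺(x) ∩ N⁺(y)|.

module Submission where

open import Defs hiding (sym)
open import Data.Bool using (Bool; true; false; _∧_; _≟_)
open import Data.Bool.Properties using (∧-commutativeMonoid; ¬-not)
open import Data.Empty using (⊥-elim)
open import Data.Fin using (Fin; zero; suc; punchIn; toℕ; _<_)
open import Data.Fin.Permutation
  using (Permutation′; _⟨$⟩ʳ_; _⟨$⟩ˡ_; inverseˡ; inverseʳ; flip; insert; insert-punchIn; id)
open import Data.Fin.Properties using (any?; all?; ¬∀⟶∃¬; pigeonhole; <-trans; <-irrefl)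
  renaming (_≟_ to _≟ᶠ_)
open import Data.Fin.Subset using (Subset; _∈_; inside; outside)
open import Data.Fin.Subset.Properties using (_∈?_)
open import Data.List using (List; []; _∷_; _++_; length; filter; allFin; map)
import Data.List as List
open import Data.List.Base using (cartesianProduct)
open import Data.List.Membership.Propositional.Properties using (∈-allFin)
open import Data.List.Properties using (filter-some)
import Data.List.Relation.Unary.Any as Any
open import Data.Nat using (ℕ; zero; suc; _+_; _*_; _≤_; z≤n; s≤s)
import Data.Nat as ℕ
open import Data.Nat.Properties
  using (+-identityʳ; +-assoc; *-comm; *-distribʳ-+; *-mono-≤; m<1+n⇒m<n∨m≡n; n<1+n; +-0-commutativeMonoid)
open import Data.Product using (Σ; ∃-syntax; _×_; _,_; proj₁; proj₂)
open import Data.Sum using (inj₁; inj₂)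
open import Data.Vec using (lookup; _∷_)
import Data.Vec as Vec
open import Data.Vec.Properties using (lookup∘tabulate; []=⇒lookup; lookup⇒[]=)
open import Algebra.Bundles using (CommutativeMonoid)
open import Algebra.Properties.CommutativeSemigroup (CommutativeMonoid.commutativeSemigroup ∧-commutativeMonoid)
  using () renaming (interchange to ∧-interchange)
open import Algebra.Properties.CommutativeMonoid.Sum +-0-commutativeMonoid using (sum; sum-permute)
open import Function using (_∘_; _$_)
open import Function.Bundles using (_⇔_; mk⇔)
open Function.Bundles.Equivalence using (to; from)
open Function.Bundles.Injection using (injective)
open import Function.Properties.Inverse using (↔⇒↣)
open import Relation.Nullary using (Dec; yes; no; does)
open import Relation.Nullary.Decidable using (_×-dec_; _⊎-dec_; does-⇔)
open import Relation.Unary using (Decidable)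
open import Relation.Binary.PropositionalEquality

private
  variable
    A B : Set
    n : ℕ

bit : Bool → ℕ
bit false = 0
bit true  = 1

countᵇ : (A → Bool) → List A → ℕ
countᵇ p []       = 0
countᵇ p (x ∷ xs) = bit (p x) + countᵇ p xs

length-filter≡countᵇ : (p : A → Bool) (xs : List A) →
  length (filter (λ a → p a ≟ true) xs) ≡ countᵇ p xs
length-filter≡countᵇ p []       = refl
length-filter≡countᵇ p (x ∷ xs) with p x
... | true  = cong suc (length-filter≡countᵇ p xs)
... | false = length-filter≡countᵇ p xs

countᵇ-cong : {p q : A → Bool} → p ≗ q → countᵇ p ≗ countᵇ q
countᵇ-cong p≗q []       = refl
countᵇ-cong p≗q (x ∷ xs) = cong₂ _+_ (cong bit (p≗q x)) (countᵇ-cong p≗q xs)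

countᵇ-++ : (p : A → Bool) (xs ys : List A) → countᵇ p (xs ++ ys) ≡ countᵇ p xs + countᵇ p ys
countᵇ-++ p []       ys = refl
countᵇ-++ p (x ∷ xs) ys =
  trans (cong (bit (p x) +_) (countᵇ-++ p xs ys)) (sym (+-assoc (bit (p x)) _ _))

countᵇ-map : (p : B → Bool) (f : A → B) (xs : List A) → countᵇ p (map f xs) ≡ countᵇ (p ∘ f) xs
countᵇ-map p f []       = refl
countᵇ-map p f (x ∷ xs) = cong (bit (p (f x)) +_) (countᵇ-map p f xs)

countᵇ-∧ˡ : (b : Bool) (q : A → Bool) (xs : List A) → countᵇ (λ x → b ∧ q x) xs ≡ bit b * countᵇ q xs
countᵇ-∧ˡ true  q xs       = sym (+-identityʳ (countᵇ q xs))
countᵇ-∧ˡ false q []       = refl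
countᵇ-∧ˡ false q (x ∷ xs) = countᵇ-∧ˡ false q xs

countᵇ-cartesianProduct : (h : A × B → Bool) (p : A → Bool) (q : B → Bool) →
  (∀ a b → h (a , b) ≡ p a ∧ q b) →
  ∀ xs ys → countᵇ h (cartesianProduct xs ys) ≡ countᵇ p xs * countᵇ q ys
countᵇ-cartesianProduct h p q h≡p∧q []       ys = refl
countᵇ-cartesianProduct h p q h≡p∧q (x ∷ xs) ys = begin
  countᵇ h (map (x ,_) ys ++ cartesianProduct xs ys)
    ≡⟨ countᵇ-++ h (map (x ,_) ys) _ ⟩
  countᵇ h (map (x ,_) ys) + countᵇ h (cartesianProduct xs ys)
    ≡⟨ cong₂ _+_ row (countᵇ-cartesianProduct h p q h≡p∧q xs ys) ⟩
  bit (p x) * countᵇ q ys + countᵇ p xs * countᵇ q ys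
    ≡⟨ *-distribʳ-+ (countᵇ q ys) (bit (p x)) (countᵇ p xs) ⟨
  countᵇ p (x ∷ xs) * countᵇ q ys ∎
  where
  open ≡-Reasoning
  row : countᵇ h (map (x ,_) ys) ≡ bit (p x) * countᵇ q ys
  row = begin
    countᵇ h (map (x ,_) ys)       ≡⟨ countᵇ-map h (x ,_) ys ⟩
    countᵇ (h ∘ (x ,_)) ys         ≡⟨ countᵇ-cong (h≡p∧q x) ys ⟩
    countᵇ (λ y → p x ∧ q y) ys    ≡⟨ countᵇ-∧ˡ (p x) q ys ⟩
    bit (p x) * countᵇ q ys        ∎

countᵇ-tabulate : (p : A → Bool) (f : Fin n → A) → countᵇ p (List.tabulate f) ≡ sum (bit ∘ p ∘ f)
countᵇ-tabulate {n = zero}  p f = refl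
countᵇ-tabulate {n = suc n} p f = cong (bit (p (f zero)) +_) (countᵇ-tabulate p (f ∘ suc))

countᵇ-permute : (p : Fin n → Bool) (π : Permutation′ n) →
  countᵇ (p ∘ (π ⟨$⟩ʳ_)) (allFin n) ≡ countᵇ p (allFin n)
countᵇ-permute p π = begin
  countᵇ (p ∘ (π ⟨$⟩ʳ_)) (allFin _) ≡⟨ countᵇ-tabulate (p ∘ (π ⟨$⟩ʳ_)) (λ i → i) ⟩
  sum (bit ∘ p ∘ (π ⟨$⟩ʳ_))        ≡⟨ sum-permute (bit ∘ p) π ⟨
  sum (bit ∘ p)                    ≡⟨ countᵇ-tabulate p (λ i → i) ⟨
  countᵇ p (allFin _)              ∎
  where open ≡-Reasoning

count-cong : {p q : Fin n → Bool} → p ≗ q → count p ≡ count q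
count-cong {p = p} {q} p≗q = begin
  count p                ≡⟨ length-filter≡countᵇ p (allFin _) ⟩
  countᵇ p (allFin _)    ≡⟨ countᵇ-cong p≗q (allFin _) ⟩
  countᵇ q (allFin _)    ≡⟨ length-filter≡countᵇ q (allFin _) ⟨
  count q                ∎
  where open ≡-Reasoning

count-permute : (p : Fin n → Bool) (π : Permutation′ n) → count (p ∘ (π ⟨$⟩ʳ_)) ≡ count p
count-permute p π = begin
  count (p ∘ (π ⟨$⟩ʳ_))              ≡⟨ length-filter≡countᵇ (p ∘ (π ⟨$⟩ʳ_)) (allFin _) ⟩
  countᵇ (p ∘ (π ⟨$⟩ʳ_)) (allFin _)  ≡⟨ countᵇ-permute p π ⟩
  countᵇ p (allFin _)                ≡⟨ length-filter≡countᵇ p (allFin _) ⟨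
  count p                            ∎
  where open ≡-Reasoning

count-pos : (p : Fin n → Bool) {z : Fin n} → p z ≡ true → 1 ≤ count p
count-pos p {z} pz = filter-some (λ a → p a ≟ true) (Any.map (λ { refl → pz }) (∈-allFin z))

pairCount-factorises : (S : Fin n → Fin n → Subset n) (x y : Fin n) (p q : Fin n → Bool) →
  (∀ i j → lookup (S i j) x ∧ lookup (S i j) y ≡ p i ∧ q j) →
  pairCount S x y ≡ count p * count q
pairCount-factorises {n} S x y p q S≡p∧q = begin
  pairCount S x y
    ≡⟨ length-filter≡countᵇ _ (cartesianProduct (allFin n) (allFin n)) ⟩
  countᵇ (λ (i , j) → lookup (S i j) x ∧ lookup (S i j) y) (cartesianProduct (allFin n) (allFin n))
    ≡⟨ countᵇ-cartesianProduct _ p q S≡p∧q (allFin n) (allFin n) ⟩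
  countᵇ p (allFin n) * countᵇ q (allFin n)
    ≡⟨ cong₂ _*_ (length-filter≡countᵇ p (allFin n)) (length-filter≡countᵇ q (allFin n)) ⟨
  count p * count q ∎
  where open ≡-Reasoning

IsTopologicalOrder : Digraph n → Permutation′ n → Set
IsTopologicalOrder D π = ∀ i k → D (π ⟨$⟩ʳ i) (π ⟨$⟩ʳ k) ≡ true → i < k

-- Walking backwards along predecessors must, by pigeonhole, revisit a vertex.
predecessors⇒cycle : {m : ℕ} (D : Digraph (suc m)) →
  (∀ y → ∃[ x ] D x y ≡ true) → ∃[ x ] Walk D x x
predecessors⇒cycle {m} D pred =
  let i , j , i<j , iterateᵢ≡iterateⱼ = pigeonhole (n<1+n (suc m)) (iterate ∘ toℕ)
  in iterate (toℕ i) , subst (λ z → Walk D z (iterate (toℕ i))) (sym iterateᵢ≡iterateⱼ) (walk i<j)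
  where
  iterate : ℕ → Fin (suc m)
  iterate zero    = zero
  iterate (suc k) = proj₁ (pred (iterate k))

  walk : ∀ {a b} → a ℕ.< b → Walk D (iterate b) (iterate a)
  walk {a} {suc b} (s≤s a≤b) with m<1+n⇒m<n∨m≡n (s≤s a≤b)
  ... | inj₁ a<b  = proj₂ (pred (iterate b)) ▸ walk a<b
  ... | inj₂ refl = arc (proj₂ (pred (iterate a)))

acyclic⇒source : {m : ℕ} (D : Digraph (suc m)) → Acyclic D → ∃[ s ] ∀ x → D x s ≡ false
acyclic⇒source D acyclic with any? (λ s → all? (λ x → D x s ≟ false))
... | yes source = source
... | no ¬source = ⊥-elim (acyclic _ (proj₂ (predecessors⇒cycle D pred)))
  where
  pred : ∀ y → ∃[ x ] D x y ≡ true
  pred y with ¬∀⟶∃¬ _ _ (λ x → D x y ≟ false) (λ all → ¬source (y , all))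
  ... | x , Dxy≢false = x , ¬-not Dxy≢false

-- A source goes first, followed by a topological order of the rest.
acyclic⇒topologicalOrder : (D : Digraph n) → Acyclic D → Σ (Permutation′ n) (IsTopologicalOrder D)
acyclic⇒topologicalOrder {zero}  D acyclic = id , λ ()
acyclic⇒topologicalOrder {suc m} D acyclic = insert zero s π , ordered
  where
  s = proj₁ (acyclic⇒source D acyclic)

  D∖s : Digraph m
  D∖s a b = D (punchIn s a) (punchIn s b)

  liftWalk : ∀ {a b} → Walk D∖s a b → Walk D (punchIn s a) (punchIn s b)
  liftWalk (arc e)  = arc e
  liftWalk (e ▸ w) = e ▸ liftWalk w

  rest = acyclic⇒topologicalOrder D∖s (λ x w → acyclic _ (liftWalk w))
  π = proj₁ rest

  ordered : IsTopologicalOrder D (insert zero s π)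
  ordered i zero e with () ← trans (sym e) (proj₂ (acyclic⇒source D acyclic) _)
  ordered zero (suc k) e = s≤s z≤n
  ordered (suc i) (suc k) e = s≤s $ proj₂ rest i k $
    subst₂ (λ a b → D a b ≡ true) (insert-punchIn zero s π i) (insert-punchIn zero s π k) e

∧≡true⇔ : {a b : Bool} → a ∧ b ≡ true ⇔ (a ≡ true × b ≡ true)
∧≡true⇔ {true}  {true}  = mk⇔ (λ _ → refl , refl) (λ _ → refl)
∧≡true⇔ {true}  {false} = mk⇔ (λ ()) proj₂
∧≡true⇔ {false} {_}     = mk⇔ (λ ()) proj₁

∈-tabulate⇔ : {f : Fin n → Bool} {x : Fin n} → x ∈ Vec.tabulate f ⇔ f x ≡ true
∈-tabulate⇔ {f = f} {x} = mk⇔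
  (λ x∈ → trans (sym (lookup∘tabulate f x)) ([]=⇒lookup x∈))
  (λ fx → lookup⇒[]= x (Vec.tabulate f) (trans (lookup∘tabulate f x) fx))

does≡true⇔ : {P : Set} (P? : Dec P) → does P? ≡ true ⇔ P
does≡true⇔ (yes p) = mk⇔ (λ _ → p) (λ _ → refl)
does≡true⇔ (no ¬p) = mk⇔ (λ ()) (⊥-elim ∘ ¬p)

does-∈? : (x : Fin n) (p : Subset n) → does (x ∈? p) ≡ lookup p x
does-∈? zero    (inside  ∷ p) = refl
does-∈? zero    (outside ∷ p) = refl
does-∈? (suc x) (b ∷ p)       = does-∈? x p

-- From an acyclic digraph to a double indexed edge clique partition

module _ (D : Digraph n) (v : Permutation′ n) where

  N⁺∩N⁻ : Fin n → Fin n → Subset n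
  N⁺∩N⁻ i j = Vec.tabulate (λ x → D (v ⟨$⟩ʳ i) x ∧ D x (v ⟨$⟩ʳ j))

  ∈N⁺∩N⁻⇔ : ∀ {i j x} → x ∈ N⁺∩N⁻ i j ⇔ (D (v ⟨$⟩ʳ i) x ≡ true × D x (v ⟨$⟩ʳ j) ≡ true)
  ∈N⁺∩N⁻⇔ = mk⇔ (to ∧≡true⇔ ∘ to ∈-tabulate⇔) (from ∈-tabulate⇔ ∘ from ∧≡true⇔)

  InA⇒arc : ∀ {i x} → InA v N⁺∩N⁻ i x → D (v ⟨$⟩ʳ i) x ≡ true
  InA⇒arc (inj₁ (_ , x∈))          = proj₁ (to ∈N⁺∩N⁻⇔ x∈)
  InA⇒arc (inj₂ (_ , _ , i∈ , refl)) = proj₂ (to ∈N⁺∩N⁻⇔ i∈)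

  InB⇒arc : ∀ {j x} → InB v N⁺∩N⁻ j x → D x (v ⟨$⟩ʳ j) ≡ true
  InB⇒arc (inj₁ (_ , x∈))          = proj₂ (to ∈N⁺∩N⁻⇔ x∈)
  InB⇒arc (inj₂ (_ , _ , j∈ , refl)) = proj₁ (to ∈N⁺∩N⁻⇔ j∈)

  -- Here A_i ∩ B_j = S_ij holds even without the hypothesis |A_i ∩ B_j| ≥ 2.
  N⁺∩N⁻-condI : CondI v N⁺∩N⁻
  N⁺∩N⁻-condI i j _ x = mk⇔
    (λ (a , b) → from ∈N⁺∩N⁻⇔ (InA⇒arc a , InB⇒arc b))
    (λ x∈ → inj₁ (j , x∈) , inj₁ (i , x∈))

  N⁺∩N⁻-condIV : IsTopologicalOrder D v → CondIV v N⁺∩N⁻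
  N⁺∩N⁻-condIV ordered i j k vₖ∈ =
    ordered i k (proj₁ (to ∈N⁺∩N⁻⇔ vₖ∈)) , ordered k j (proj₂ (to ∈N⁺∩N⁻⇔ vₖ∈))

  pairCount-N⁺∩N⁻ : ∀ x y → pairCount N⁺∩N⁻ x y ≡ commonIn D x y * commonOut D x y
  pairCount-N⁺∩N⁻ x y = begin
    pairCount N⁺∩N⁻ x y
      ≡⟨ pairCount-factorises N⁺∩N⁻ x y (in-x∧y ∘ (v ⟨$⟩ʳ_)) (out-x∧y ∘ (v ⟨$⟩ʳ_)) lookup-factorises ⟩
    count (in-x∧y ∘ (v ⟨$⟩ʳ_)) * count (out-x∧y ∘ (v ⟨$⟩ʳ_))
      ≡⟨ cong₂ _*_ (count-permute in-x∧y v) (count-permute out-x∧y v) ⟩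
    commonIn D x y * commonOut D x y ∎
    where
    open ≡-Reasoning
    in-x∧y out-x∧y : Fin n → Bool
    in-x∧y z  = D z x ∧ D z y
    out-x∧y z = D x z ∧ D y z
    lookup-factorises : ∀ i j → lookup (N⁺∩N⁻ i j) x ∧ lookup (N⁺∩N⁻ i j) y
                              ≡ in-x∧y (v ⟨$⟩ʳ i) ∧ out-x∧y (v ⟨$⟩ʳ j)
    lookup-factorises i j rewrite lookup∘tabulate (λ z → D (v ⟨$⟩ʳ i) z ∧ D z (v ⟨$⟩ʳ j)) x
                                | lookup∘tabulate (λ z → D (v ⟨$⟩ʳ i) z ∧ D z (v ⟨$⟩ʳ j)) y =
      ∧-interchange (D (v ⟨$⟩ʳ i) x) (D x (v ⟨$⟩ʳ j)) (D (v ⟨$⟩ʳ i) y) (D y (v ⟨$⟩ʳ j))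

  N⁺∩N⁻-isDoubleIndexedECP : ∀ {M} → IsDCM M D → IsDoubleIndexedECP M N⁺∩N⁻
  N⁺∩N⁻-isDoubleIndexedECP {M} isDCM = clique , partition
    where
    clique : ∀ i j → IsClique M (N⁺∩N⁻ i j)
    clique i j x y x∈ y∈ x≢y = subst (1 ≤_) (sym (isDCM x y x≢y)) $
      *-mono-≤ (count-pos (λ z → D x z ∧ D y z) (from ∧≡true⇔ (proj₂ x∈′ , proj₂ y∈′)))
               (count-pos (λ z → D z x ∧ D z y) (from ∧≡true⇔ (proj₁ x∈′ , proj₁ y∈′)))
      where
      x∈′ = to ∈N⁺∩N⁻⇔ x∈
      y∈′ = to ∈N⁺∩N⁻⇔ y∈
    partition : ∀ x y → x ≢ y → pairCount N⁺∩N⁻ x y ≡ mult M x y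
    partition x y x≢y = begin
      pairCount N⁺∩N⁻ x y               ≡⟨ pairCount-N⁺∩N⁻ x y ⟩
      commonIn D x y * commonOut D x y  ≡⟨ *-comm (commonIn D x y) (commonOut D x y) ⟩
      commonOut D x y * commonIn D x y  ≡⟨ isDCM x y x≢y ⟨
      mult M x y ∎
      where open ≡-Reasoning

-- From a double indexed edge clique partition to an acyclic digraph

module _ (v : Permutation′ n) (S : Fin n → Fin n → Subset n) where

  InA? : ∀ i → Decidable (InA v S i)
  InA? i x = any? (λ p → x ∈? S i p)
    ⊎-dec any? (λ a → any? (λ b → (v ⟨$⟩ʳ i ∈? S a b) ×-dec (x ≟ᶠ v ⟨$⟩ʳ b)))

  InB? : ∀ j → Decidable (InB v S j)
  InB? j x = any? (λ q → x ∈? S q j)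
    ⊎-dec any? (λ a → any? (λ b → (v ⟨$⟩ʳ j ∈? S a b) ×-dec (x ≟ᶠ v ⟨$⟩ʳ a)))

  InA⇔InB : ∀ {i k} → InA v S i (v ⟨$⟩ʳ k) ⇔ InB v S k (v ⟨$⟩ʳ i)
  InA⇔InB {i} {k} = mk⇔ A⇒B B⇒A
    where
    A⇒B : InA v S i (v ⟨$⟩ʳ k) → InB v S k (v ⟨$⟩ʳ i)
    A⇒B (inj₁ (p , vₖ∈))            = inj₂ (i , p , vₖ∈ , refl)
    A⇒B (inj₂ (a , b , vᵢ∈ , vₖ≡vᵦ)) =
      inj₁ (a , subst (λ c → v ⟨$⟩ʳ i ∈ S a c) (sym (injective (↔⇒↣ v) vₖ≡vᵦ)) vᵢ∈)
    B⇒A : InB v S k (v ⟨$⟩ʳ i) → InA v S i (v ⟨$⟩ʳ k)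
    B⇒A (inj₁ (q , vᵢ∈))            = inj₂ (q , k , vᵢ∈ , refl)
    B⇒A (inj₂ (a , b , vₖ∈ , vᵢ≡vₐ)) =
      inj₁ (b , subst (λ c → v ⟨$⟩ʳ k ∈ S c b) (sym (injective (↔⇒↣ v) vᵢ≡vₐ)) vₖ∈)

  InA⇒index< : CondIV v S → ∀ {i x} → InA v S i x → i < v ⟨$⟩ˡ x
  InA⇒index< condIV {i} {x} (inj₁ (p , x∈)) =
    proj₁ (condIV i p (v ⟨$⟩ˡ x) (subst (_∈ S i p) (sym (inverseʳ v)) x∈))
  InA⇒index< condIV {i} (inj₂ (a , b , vᵢ∈ , refl)) =
    subst (i <_) (sym (inverseˡ v)) (proj₂ (condIV a b i vᵢ∈))

  pair∈S⇔ : CondI v S → ∀ {x y} → x ≢ y → ∀ i j →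
    (x ∈ S i j × y ∈ S i j) ⇔ ((InA v S i x × InA v S i y) × (InB v S j x × InB v S j y))
  pair∈S⇔ condI {x} {y} x≢y i j = mk⇔
    (λ (x∈ , y∈) → (inj₁ (j , x∈) , inj₁ (j , y∈)) , (inj₁ (i , x∈) , inj₁ (i , y∈)))
    (λ ((x∈A , y∈A) , (x∈B , y∈B)) →
      let atLeastTwo = x , y , x≢y , (x∈A , x∈B) , (y∈A , y∈B)
      in to (condI i j atLeastTwo x) (x∈A , x∈B) , to (condI i j atLeastTwo y) (y∈A , y∈B))

  digraphOf : Digraph n
  digraphOf u w = does (InA? (v ⟨$⟩ˡ u) w)

  arc⇒index< : CondIV v S → ∀ {u w} → digraphOf u w ≡ true → v ⟨$⟩ˡ u < v ⟨$⟩ˡ w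
  arc⇒index< condIV {u} {w} e = InA⇒index< condIV (to (does≡true⇔ (InA? (v ⟨$⟩ˡ u) w)) e)

  digraphOf-acyclic : CondIV v S → Acyclic digraphOf
  digraphOf-acyclic condIV x w = <-irrefl refl (walk⇒index< w)
    where
    walk⇒index< : ∀ {u w} → Walk digraphOf u w → v ⟨$⟩ˡ u < v ⟨$⟩ˡ w
    walk⇒index< (arc e)  = arc⇒index< condIV e
    walk⇒index< (e ▸ w) = <-trans (arc⇒index< condIV e) (walk⇒index< w)

  arc-into-vertex : ∀ x j → digraphOf x (v ⟨$⟩ʳ j) ≡ does (InB? j x)
  arc-into-vertex x j =
    does-⇔ (subst (λ z → InA v S (v ⟨$⟩ˡ x) (v ⟨$⟩ʳ j) ⇔ InB v S j z) (inverseʳ v) InA⇔InB)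
      (InA? (v ⟨$⟩ˡ x) (v ⟨$⟩ʳ j)) (InB? j x)

  digraphOf-isDCM : ∀ {M} → IsDoubleIndexedECP M S → CondI v S → IsDCM M digraphOf
  digraphOf-isDCM {M} (_ , partition) condI x y x≢y = begin
    mult M x y                                    ≡⟨ partition x y x≢y ⟨
    pairCount S x y                               ≡⟨ pairCount-factorises S x y x,y∈A x,y∈B lookup-factorises ⟩
    count x,y∈A * count x,y∈B                     ≡⟨ *-comm (count x,y∈A) (count x,y∈B) ⟩
    count x,y∈B * count x,y∈A                     ≡⟨ cong₂ _*_ commonOut≡ (count-permute x,y∈A (flip v)) ⟨
    commonOut digraphOf x y * commonIn digraphOf x y ∎
    where
    open ≡-Reasoning
    x,y∈A x,y∈B : Fin n → Bool
    x,y∈A i = does (InA? i x ×-dec InA? i y)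
    x,y∈B j = does (InB? j x ×-dec InB? j y)
    lookup-factorises : ∀ i j → lookup (S i j) x ∧ lookup (S i j) y ≡ x,y∈A i ∧ x,y∈B j
    lookup-factorises i j = begin
      lookup (S i j) x ∧ lookup (S i j) y      ≡⟨ cong₂ _∧_ (does-∈? x (S i j)) (does-∈? y (S i j)) ⟨
      does ((x ∈? S i j) ×-dec (y ∈? S i j))   ≡⟨ does-⇔ (pair∈S⇔ condI x≢y i j) ((x ∈? S i j) ×-dec (y ∈? S i j))
                                                   ((InA? i x ×-dec InA? i y) ×-dec (InB? j x ×-dec InB? j y)) ⟩
      x,y∈A i ∧ x,y∈B j                        ∎
    commonOut≡ : commonOut digraphOf x y ≡ count x,y∈B
    commonOut≡ = begin
      commonOut digraphOf x y
        ≡⟨ count-permute (λ w → digraphOf x w ∧ digraphOf y w) v ⟨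
      count (λ j → digraphOf x (v ⟨$⟩ʳ j) ∧ digraphOf y (v ⟨$⟩ʳ j))
        ≡⟨ count-cong (λ j → cong₂ _∧_ (arc-into-vertex x j) (arc-into-vertex y j)) ⟩
      count x,y∈B ∎

theorem2p5 : ∀ (n : ℕ) (M : Multigraph n) →
    (∃[ D ] (Acyclic D × IsDCM M D)) ⇔
    (∃[ v ] ∃[ S ] (IsDoubleIndexedECP M S × CondI v S × CondIV v S))
theorem2p5 n M = mk⇔
  (λ (D , acyclic , isDCM) →
    let v , ordered = acyclic⇒topologicalOrder {n} D acyclic
    in v , N⁺∩N⁻ D v , N⁺∩N⁻-isDoubleIndexedECP D v {M} isDCM , N⁺∩N⁻-condI D v , N⁺∩N⁻-condIV D v ordered)
  (λ (v , S , ecp , condI , condIV) →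
    digraphOf v S , digraphOf-acyclic v S condIV , digraphOf-isDCM v S {M} ecp condI)
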